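{- Let $A\in\{P,I\}$ be an augmentation operator and $A'$ the other one. For every composition $\mathbf{c}$ with at least $2$ entries: if $\mathbf{c}$ has an odd number of entries then $A(F(\mathbf{c}))=F(A(\mathbf{c}))$, and if $\mathbf{c}$ has an even number of entries then $A(F(\mathbf{c}))=F(A'(\mathbf{c}))$.
   Context: On nonempty compositions (finite sequences of positive integers) define the augmentation operators $P$: prepend an entry $1$, and $I$: add $1$ to the first entry. The map $F$ on compositions is the following: number the entries of $\mathbf{c}=(c_1,\dots,c_h)$ from the end ($c_h$ in position 1, $c_{h-1}$ in position 2, etc.); simultaneously, every entry $c$ in an even position is replaced by $c-1$ entries equal to $1$ and its left neighbor is increased by $1$, where, if $c_1$ is in an even position, its missing left neighbor is regarded as an entry $0$ that becomes $1$. (E.g. $(4,2,1,5,2,3)\mapsto(1,1,1,1,3,6,1,3)$, $(2,1)\mapsto(1,1,1)$.) This is the map induced on compositions of $n$ by a bijection on Dyck paths via the correspondence between $DUU$-avoiding Dyck $n$-paths of height $h$ and compositions $(c_1,\dots,c_h)$ of $n$, $c_i$ being the number of downsteps ending at height $h-i$. -}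

module Defs where

open import Data.Nat using (ℕ; zero; suc; _∸_; _<_)
open import Data.List using (List; []; _∷_; _++_; [_]; replicate; reverse; length)
open import Data.List.Relation.Unary.All using (All)

-- A composition: a list of positive integers (nonemptiness is imposed
-- separately where needed; in lemma3 the length is ≥ 2).
IsComposition : List ℕ → Set
IsComposition c = All (0 <_) c

P : List ℕ → List ℕ
P c = 1 ∷ c

I : List ℕ → List ℕ
I [] = []
I (c ∷ cs) = suc c ∷ cs

-- It is computed on the REVERSED composition
-- (c_h, c_{h-1}, ..., c_1), i.e. entries listed by position 1, 2, 3, ...
-- 'Fodd b r' processes r whose head is at an odd position; b is the amount
-- that entry is increased (1 if it is the left neighbour of an even-position
-- entry, i.e. its position is ≥ 3; 0 for position 1).
-- Output is in the original (left-to-right) order.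
mutual
  Fodd : ℕ → List ℕ → List ℕ
  Fodd b [] = []
  Fodd b (o ∷ rest) = Feven rest ++ [ o Data.Nat.+ b ]

  -- head of the argument is at an even position
  Feven : List ℕ → List ℕ
  Feven [] = []
  Feven (e ∷ rest) = Fleft rest ++ replicate (e ∸ 1) 1

  -- left neighbour of an even-position entry: an odd entry increased by 1,
  -- or a missing entry regarded as 0 which becomes 1.
  Fleft : List ℕ → List ℕ
  Fleft [] = [ 1 ]
  Fleft (o ∷ rest) = Fodd 1 (o ∷ rest)

F : List ℕ → List ℕ
F c = Fodd 0 (reverse c)

data Op : Set where
  opP opI : Op

apply : Op → List ℕ → List ℕ
apply opP = P
apply opI = I

other : Op → Op
other opP = opI
other opI = opP

module Submission where

open import Defs
open import Data.Nat using (ℕ; suc; _+_; _∸_; _≤_; _%_; s≤s; z≤n)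
open import Data.List using (List; []; _∷_; _++_; [_]; _∷ʳ_; replicate; reverse; length)
open import Data.List.Properties using (++-conicalˡ; ++-conicalʳ; unfold-reverse; length-reverse)
open import Data.List.Relation.Unary.All using (_∷_)
open import Data.Product using (_×_; _,_)
open import Function using (_∘_)
open import Relation.Binary.PropositionalEquality
  using (_≡_; _≢_; refl; trans; cong; module ≡-Reasoning)
open import Relation.Nullary using (contradiction)

open ≡-Reasoning

-- F c is computed on reverse c, where the first entry c₁ is the LAST one: there
-- P c appends 1 and I c increments the last entry.  If h is odd, c₁ is the left
-- neighbour of c₂ and becomes c₁ + 1; a prepended 1 would sit at an even
-- position and only contribute a new leading 1 (its missing neighbour), and
-- incrementing c₁ increments that leading c₁ + 1.  If h is even, F c starts
-- with the block 1, 1^(c₁ - 1); incrementing c₁ lengthens this block by one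
-- leading 1, while a prepended 1 is an odd-position neighbour raised to 2,
-- replacing the leading 1 by 2.

I-++ : ∀ xs ys → xs ≢ [] → I (xs ++ ys) ≡ I xs ++ ys
I-++ []      _ xs≢[] = contradiction refl xs≢[]
I-++ (_ ∷ _) _ _     = refl

Fleft-≢[] : ∀ u → Fleft u ≢ []
Fleft-≢[] []      ()
Fleft-≢[] (_ ∷ u) eq with () ← ++-conicalʳ (Feven u) _ eq

Feven-∷ʳ-≢[] : ∀ t x → Feven (t ∷ʳ x) ≢ []
Feven-∷ʳ-≢[] []      x ()
Feven-∷ʳ-≢[] (_ ∷ r) x = Fleft-≢[] (r ∷ʳ x) ∘ ++-conicalˡ _ _

Fleft-∷ʳ : ∀ t x → Fleft (t ∷ʳ x) ≡ Fodd 1 (t ∷ʳ x)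
Fleft-∷ʳ []      x = refl
Fleft-∷ʳ (_ ∷ _) x = refl

-- The parity hypotheses are about h = length (s ∷ʳ y); since (2 + n) % 2 reduces to
-- n % 2, they pass unchanged to the recursive calls and rule out the wrong base case.
Fodd-∷ʳ-1-odd : ∀ b s y → suc (length s) % 2 ≡ 1 →
                Fodd b (s ∷ʳ y ∷ʳ 1) ≡ 1 ∷ Fodd b (s ∷ʳ y)
Fodd-∷ʳ-1-odd b []           y _ = refl
Fodd-∷ʳ-1-odd b (_ ∷ [])     y ()
Fodd-∷ʳ-1-odd b (a ∷ a′ ∷ t) y odd =
  cong (λ xs → (xs ++ replicate (a′ ∸ 1) 1) ++ [ a + b ]) (begin
    Fleft (t ∷ʳ y ∷ʳ 1)   ≡⟨ Fleft-∷ʳ (t ∷ʳ y) 1 ⟩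
    Fodd 1 (t ∷ʳ y ∷ʳ 1)  ≡⟨ Fodd-∷ʳ-1-odd 1 t y odd ⟩
    1 ∷ Fodd 1 (t ∷ʳ y)   ≡⟨ cong (1 ∷_) (Fleft-∷ʳ t y) ⟨
    1 ∷ Fleft (t ∷ʳ y)    ∎)

I-Fodd-∷ʳ-odd : ∀ b s y → suc (length s) % 2 ≡ 1 →
                I (Fodd b (s ∷ʳ y)) ≡ Fodd b (s ∷ʳ suc y)
I-Fodd-∷ʳ-odd b []           y _ = refl
I-Fodd-∷ʳ-odd b (_ ∷ [])     y ()
I-Fodd-∷ʳ-odd b (a ∷ a′ ∷ t) y odd = begin
  I ((Fleft (t ∷ʳ y) ++ R) ++ [ a + b ])
    ≡⟨ I-++ _ _ (Fleft-≢[] (t ∷ʳ y) ∘ ++-conicalˡ _ R) ⟩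
  I (Fleft (t ∷ʳ y) ++ R) ++ [ a + b ]
    ≡⟨ cong (_++ [ a + b ]) (I-++ _ R (Fleft-≢[] (t ∷ʳ y))) ⟩
  (I (Fleft (t ∷ʳ y)) ++ R) ++ [ a + b ]
    ≡⟨ cong (λ xs → (xs ++ R) ++ [ a + b ]) I-Fleft ⟩
  (Fleft (t ∷ʳ suc y) ++ R) ++ [ a + b ]
    ∎
  where
  R = replicate (a′ ∸ 1) 1
  I-Fleft : I (Fleft (t ∷ʳ y)) ≡ Fleft (t ∷ʳ suc y)
  I-Fleft = begin
    I (Fleft (t ∷ʳ y))    ≡⟨ cong I (Fleft-∷ʳ t y) ⟩
    I (Fodd 1 (t ∷ʳ y))   ≡⟨ I-Fodd-∷ʳ-odd 1 t y odd ⟩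
    Fodd 1 (t ∷ʳ suc y)   ≡⟨ Fleft-∷ʳ t (suc y) ⟨
    Fleft (t ∷ʳ suc y)    ∎

Feven-∷ʳ-suc : ∀ t y → length t % 2 ≡ 0 →
               Feven (t ∷ʳ suc (suc y)) ≡ 1 ∷ Feven (t ∷ʳ suc y)
Feven-∷ʳ-suc []           y _ = refl
Feven-∷ʳ-suc (_ ∷ [])     y ()
Feven-∷ʳ-suc (a ∷ a′ ∷ t) y even =
  cong (λ xs → (xs ++ [ a′ + 1 ]) ++ replicate (a ∸ 1) 1) (Feven-∷ʳ-suc t y even)

I-Feven-∷ʳ : ∀ t y → length t % 2 ≡ 0 →
             I (Feven (t ∷ʳ suc y)) ≡ Feven (t ∷ʳ suc y ∷ʳ 1)
I-Feven-∷ʳ []           y _ = refl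
I-Feven-∷ʳ (_ ∷ [])     y ()
I-Feven-∷ʳ (a ∷ a′ ∷ t) y even = begin
  I ((Feven (t ∷ʳ suc y) ++ [ a′ + 1 ]) ++ R)
    ≡⟨ I-++ _ R (Fleft-≢[] (a′ ∷ t ∷ʳ suc y)) ⟩
  I (Feven (t ∷ʳ suc y) ++ [ a′ + 1 ]) ++ R
    ≡⟨ cong (_++ R) (I-++ _ _ (Feven-∷ʳ-≢[] t (suc y))) ⟩
  (I (Feven (t ∷ʳ suc y)) ++ [ a′ + 1 ]) ++ R
    ≡⟨ cong (λ xs → (xs ++ [ a′ + 1 ]) ++ R) (I-Feven-∷ʳ t y even) ⟩
  (Feven (t ∷ʳ suc y ∷ʳ 1) ++ [ a′ + 1 ]) ++ R
    ∎
  where R = replicate (a ∸ 1) 1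

Fodd-∷ʳ-suc-even : ∀ b s y → suc (length s) % 2 ≡ 0 →
                   Fodd b (s ∷ʳ suc (suc y)) ≡ 1 ∷ Fodd b (s ∷ʳ suc y)
Fodd-∷ʳ-suc-even b []      y ()
Fodd-∷ʳ-suc-even b (a ∷ t) y even = cong (_++ [ a + b ]) (Feven-∷ʳ-suc t y even)

I-Fodd-∷ʳ-even : ∀ b s y → suc (length s) % 2 ≡ 0 →
                 I (Fodd b (s ∷ʳ suc y)) ≡ Fodd b (s ∷ʳ suc y ∷ʳ 1)
I-Fodd-∷ʳ-even b []      y ()
I-Fodd-∷ʳ-even b (a ∷ t) y even = begin
  I (Feven (t ∷ʳ suc y) ++ [ a + b ])    ≡⟨ I-++ _ _ (Feven-∷ʳ-≢[] t (suc y)) ⟩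
  I (Feven (t ∷ʳ suc y)) ++ [ a + b ]    ≡⟨ cong (_++ [ a + b ]) (I-Feven-∷ʳ t y even) ⟩
  Feven (t ∷ʳ suc y ∷ʳ 1) ++ [ a + b ]   ∎

F-∷ : ∀ c₁ cs → F (c₁ ∷ cs) ≡ Fodd 0 (reverse cs ∷ʳ c₁)
F-∷ c₁ cs = cong (Fodd 0) (unfold-reverse c₁ cs)

F-P-∷ : ∀ c₁ cs → F (P (c₁ ∷ cs)) ≡ Fodd 0 (reverse cs ∷ʳ c₁ ∷ʳ 1)
F-P-∷ c₁ cs =
  cong (Fodd 0) (trans (unfold-reverse 1 (c₁ ∷ cs)) (cong (_∷ʳ 1) (unfold-reverse c₁ cs)))

suc-length-reverse-%2 : ∀ {A : Set} (xs : List A) {r} →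
                        suc (length xs) % 2 ≡ r → suc (length (reverse xs)) % 2 ≡ r
suc-length-reverse-%2 xs = trans (cong (λ n → suc n % 2) (length-reverse xs))

F-commute-odd : ∀ A c₁ cs → length (c₁ ∷ cs) % 2 ≡ 1 →
                apply A (F (c₁ ∷ cs)) ≡ F (apply A (c₁ ∷ cs))
F-commute-odd opP c₁ cs odd = begin
  1 ∷ F (c₁ ∷ cs)
    ≡⟨ cong (1 ∷_) (F-∷ c₁ cs) ⟩
  1 ∷ Fodd 0 (reverse cs ∷ʳ c₁)
    ≡⟨ Fodd-∷ʳ-1-odd 0 (reverse cs) c₁ (suc-length-reverse-%2 cs odd) ⟨
  Fodd 0 (reverse cs ∷ʳ c₁ ∷ʳ 1)
    ≡⟨ F-P-∷ c₁ cs ⟨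
  F (P (c₁ ∷ cs))
    ∎
F-commute-odd opI c₁ cs odd = begin
  I (F (c₁ ∷ cs))
    ≡⟨ cong I (F-∷ c₁ cs) ⟩
  I (Fodd 0 (reverse cs ∷ʳ c₁))
    ≡⟨ I-Fodd-∷ʳ-odd 0 (reverse cs) c₁ (suc-length-reverse-%2 cs odd) ⟩
  Fodd 0 (reverse cs ∷ʳ suc c₁)
    ≡⟨ F-∷ (suc c₁) cs ⟨
  F (I (c₁ ∷ cs))
    ∎

F-swap-even : ∀ A c₁ cs → length (suc c₁ ∷ cs) % 2 ≡ 0 →
              apply A (F (suc c₁ ∷ cs)) ≡ F (apply (other A) (suc c₁ ∷ cs))
F-swap-even opP c₁ cs even = begin
  1 ∷ F (suc c₁ ∷ cs)
    ≡⟨ cong (1 ∷_) (F-∷ (suc c₁) cs) ⟩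
  1 ∷ Fodd 0 (reverse cs ∷ʳ suc c₁)
    ≡⟨ Fodd-∷ʳ-suc-even 0 (reverse cs) c₁ (suc-length-reverse-%2 cs even) ⟨
  Fodd 0 (reverse cs ∷ʳ suc (suc c₁))
    ≡⟨ F-∷ (suc (suc c₁)) cs ⟨
  F (I (suc c₁ ∷ cs))
    ∎
F-swap-even opI c₁ cs even = begin
  I (F (suc c₁ ∷ cs))
    ≡⟨ cong I (F-∷ (suc c₁) cs) ⟩
  I (Fodd 0 (reverse cs ∷ʳ suc c₁))
    ≡⟨ I-Fodd-∷ʳ-even 0 (reverse cs) c₁ (suc-length-reverse-%2 cs even) ⟩
  Fodd 0 (reverse cs ∷ʳ suc c₁ ∷ʳ 1)
    ≡⟨ F-P-∷ (suc c₁) cs ⟨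
  F (P (suc c₁ ∷ cs))
    ∎

lemma3 : (A : Op) (c : List ℕ) → IsComposition c → 2 ≤ length c →
    (length c % 2 ≡ 1 → apply A (F c) ≡ F (apply A c)) ×
    (length c % 2 ≡ 0 → apply A (F c) ≡ F (apply (other A) c))
lemma3 A []            _              ()
lemma3 A (suc c₁ ∷ cs) (s≤s z≤n ∷ _) _ =
  F-commute-odd A (suc c₁) cs , F-swap-even A c₁ cs
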